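{- Let $n\geq 4$ be an even integer and let $R_{(n,2)}$ be a regular graph of order $n$ in which every vertex has degree $n-2$ (equivalently, the complete graph $K_n$ with the $n/2$ edges of a perfect matching removed). Then $rvcl(R_{(n,2)})=\frac{n}{2}+1$.
   Context: All graphs are finite, simple, undirected and connected; $d(u,v)$ denotes the distance in the graph, and for $S\subseteq V(G)$, $d(v,S)=\min\{d(v,y): y\in S\}$. A path between $x$ and $y$ is a rainbow vertex path (with respect to a vertex coloring) if its internal vertices all receive distinct colors. A rainbow vertex $k$-coloring of $G$ is a map $c:V(G)\to\{1,\dots,k\}$ such that every two distinct vertices $x,y$ are joined by a rainbow vertex $x$–$y$ path. For $i\in\{1,\dots,k\}$ let $R_i$ be the set of vertices of color $i$; the rainbow code of $v$ is $rc_\Pi(v)=(d(v,R_1),\dots,d(v,R_k))$. A rainbow vertex $k$-coloring is a locating rainbow $k$-coloring if all vertices have pairwise distinct rainbow codes. The locating rainbow connection number $rvcl(G)$ is the smallest $k$ for which $G$ has a locating rainbow $k$-coloring. -}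

module Defs where

open import Data.Nat using (ℕ; zero; suc; _+_; _*_; _∸_; _≤_)
open import Data.Fin using (Fin)
open import Data.Bool using (Bool; T)
open import Data.List using (List; []; _∷_; _++_; [_]; map; length; filterᵇ; allFin)
open import Data.List.Relation.Unary.Linked using (Linked)
open import Data.List.Relation.Unary.Unique.Propositional using (Unique)
open import Data.Product using (Σ; ∃; _×_)
open import Relation.Binary.PropositionalEquality using (_≡_; _≢_)
open import Relation.Nullary using (¬_)
open import Function.Definitions using (Surjective)

record Graph (n : ℕ) : Set where
  field
    adj    : Fin n → Fin n → Bool
    sym    : ∀ u v → T (adj u v) → T (adj v u)
    irrefl : ∀ u → ¬ T (adj u u)

module _ {n : ℕ} (G : Graph n) where
  open Graph G

  Adj : Fin n → Fin n → Set
  Adj u v = T (adj u v)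

  degree : Fin n → ℕ
  degree v = length (filterᵇ (adj v) (allFin n))

  data Walk : Fin n → Fin n → ℕ → Set where
    here : ∀ {u} → Walk u u 0
    step : ∀ {u v w m} → Adj u v → Walk v w m → Walk u w (suc m)

  Connected : Set
  Connected = ∀ u v → ∃ λ m → Walk u v m

  SetDist : Fin n → (Fin n → Set) → ℕ → Set
  SetDist v S m =
    (Σ (Fin n) λ y → S y × Walk v y m) ×
    (∀ y m' → S y → Walk v y m' → m ≤ m')

  module _ {k : ℕ} (c : Fin n → Fin k) where

    R : Fin k → Fin n → Set
    R i v = c v ≡ i

    RainbowPath : Fin n → Fin n → Set
    RainbowPath x y = Σ (List (Fin n)) λ inner →
      Linked Adj (x ∷ inner ++ [ y ]) ×
      Unique (x ∷ inner ++ [ y ]) ×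
      Unique (map c inner)

    IsRainbowColoring : Set
    IsRainbowColoring = ∀ x y → x ≢ y → RainbowPath x y

    IsRainbowCode : Fin n → (Fin k → ℕ) → Set
    IsRainbowCode v r = ∀ i → SetDist v (R i) (r i)

    -- c (with all k colours used, so that Π = {R_1..R_k} is a partition)
    -- is a locating rainbow k-coloring
    IsLocatingRainbowColoring : Set
    IsLocatingRainbowColoring =
      Surjective _≡_ _≡_ c ×
      IsRainbowColoring ×
      (∀ u v (ru rv : Fin k → ℕ) → IsRainbowCode u ru → IsRainbowCode v rv →
         (∀ i → ru i ≡ rv i) → u ≡ v)

  HasLocatingRainbowColoring : ℕ → Set
  HasLocatingRainbowColoring k =
    Σ (Fin n → Fin k) λ c → IsLocatingRainbowColoring c

  RVCL≡ : ℕ → Set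
  RVCL≡ k = HasLocatingRainbowColoring k ×
            (∀ j → HasLocatingRainbowColoring j → k ≤ j)

-- Every vertex v has exactly one non-neighbour, its partner, so any two vertices are
-- joined by a path with at most one internal vertex: every colouring is rainbow and all
-- rainbow codes have entries 0, 1 or 2, where d(v , R i) = 2 exactly when R i = {partner v}.
-- In a locating colouring with k colours a vertex is therefore determined either by a colour
-- at distance 2 or by its own colour; this injects the n vertices into two copies of the k
-- colours and misses the second copy of any colour used twice, so n < 2k and k ≥ m + 1.
-- Conversely, colouring the smaller vertex of each pair with a colour of its own and all the
-- others with one common colour uses m + 1 colours, and a vertex of the common colour is
-- located by the 2 in its code at the colour of its partner.

module Submission where

open import Defs
open import Data.Nat using (ℕ; zero; suc; _+_; _*_; _∸_; _≤_; _<_; z≤n; s≤s)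
import Data.Nat.Properties as ℕ
open import Data.Fin as Fin using (Fin; zero; suc; punchIn; punchOut)
import Data.Fin.Properties as FinP
open import Data.Bool.Properties using (T?)
open import Data.Empty using (⊥-elim)
open import Data.Sum using (_⊎_; inj₁; inj₂)
open import Data.Sum.Properties using (inj₁-injective)
open import Data.List using (List; []; _∷_; length; filter; allFin; lookup)
open import Data.List.Properties using (length-tabulate)
open import Data.List.Membership.Propositional using (_∈_)
open import Data.List.Membership.Propositional.Properties
  using (∈-allFin; ∈-lookup; ∈-filter⁺; ∈-filter⁻)
import Data.List.Membership.Setoid.Properties as SetoidMembership
open import Data.List.Relation.Unary.Any using (here; there; index)
open import Data.List.Relation.Unary.Any.Properties using (lookup-index)
import Data.List.Relation.Unary.All as All
open All using ([]; _∷_)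
open import Data.List.Relation.Unary.AllPairs using ([]; _∷_)
open import Data.List.Relation.Unary.Linked using ([-]; _∷_)
open import Data.List.Relation.Unary.Unique.Propositional using (Unique)
open import Data.List.Relation.Unary.Unique.Propositional.Properties using (allFin⁺; filter⁺)
open import Data.Product using (∃; _×_; _,_; proj₁; proj₂)
open import Function using (_∘_)
open import Level using (0ℓ)
open import Function.Definitions using (Injective; Surjective)
open import Relation.Binary.PropositionalEquality
  using (_≡_; _≢_; refl; sym; trans; cong; subst; setoid; ≢-sym; module ≡-Reasoning)
open import Relation.Nullary using (¬_; yes; no; ¬?; _×-dec_)
open import Relation.Nullary.Decidable using (decidable-stable)
open import Relation.Unary using (Pred; Decidable)

module _ {A : Set} where

  length-filter-complement : ∀ {p} {P : Pred A p} (P? : Decidable P) (xs : List A) →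
    length (filter P? xs) + length (filter (¬? ∘ P?) xs) ≡ length xs
  length-filter-complement P? [] = refl
  length-filter-complement P? (x ∷ xs) with P? x
  ... | yes _ = cong suc (length-filter-complement P? xs)
  ... | no  _ = trans (ℕ.+-suc _ _) (cong suc (length-filter-complement P? xs))

  lookup-injective : {xs : List A} → Unique xs → Injective _≡_ _≡_ (lookup xs)
  lookup-injective (_ ∷ _)  {zero}  {zero}  _ = refl
  lookup-injective (x≢ ∷ _) {zero}  {suc j} e = ⊥-elim (All.lookup x≢ (∈-lookup j) e)
  lookup-injective (x≢ ∷ _) {suc i} {zero}  e = ⊥-elim (All.lookup x≢ (∈-lookup i) (sym e))
  lookup-injective (_ ∷ u)  {suc i} {suc j} e = cong suc (lookup-injective u e)

  injective⇒≤length : {k : ℕ} {xs : List A} (f : Fin k → A) → Injective _≡_ _≡_ f →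
    (∀ i → f i ∈ xs) → k ≤ length xs
  injective⇒≤length f f-inj f∈xs = FinP.injective⇒≤ {f = index ∘ f∈xs}
    (f-inj ∘ SetoidMembership.index-injective (setoid _) (f∈xs _) (f∈xs _))

  other-in-pair : {xs : List A} {x : A} → Unique xs → length xs ≡ 2 → x ∈ xs →
    ∃ λ y → y ∈ xs × y ≢ x × (∀ {z} → z ∈ xs → z ≢ x → z ≡ y)
  other-in-pair ((a≢b ∷ []) ∷ _) refl (here refl) =
    _ , there (here refl) , ≢-sym a≢b ,
    λ { (here refl) z≢x → ⊥-elim (z≢x refl) ; (there (here refl)) _ → refl }
  other-in-pair ((a≢b ∷ []) ∷ _) refl (there (here refl)) =
    _ , here refl , a≢b ,
    λ { (here refl) _ → refl ; (there (here refl)) z≢x → ⊥-elim (z≢x refl) }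

length-filter-≤-via-injection : ∀ {N p q} {P : Pred (Fin N) p} {Q : Pred (Fin N) q}
  (P? : Decidable P) (Q? : Decidable Q)
  (f : Fin N → Fin N) → Injective _≡_ _≡_ f → (∀ {x} → P x → Q (f x)) →
  length (filter P? (allFin N)) ≤ length (filter Q? (allFin N))
length-filter-≤-via-injection {N} P? Q? f f-inj f-maps = injective⇒≤length (f ∘ lookup Ps)
  (lookup-injective (filter⁺ P? (allFin⁺ N)) ∘ f-inj)
  (λ i → ∈-filter⁺ Q? (∈-allFin _)
    (f-maps (proj₂ (∈-filter⁻ P? {xs = allFin N} (∈-lookup {xs = Ps} i)))))
  where
  Ps : List (Fin N)
  Ps = filter P? (allFin N)

third-vertex : ∀ {n} (x y : Fin (3 + n)) → ∃ λ w → w ≢ x × w ≢ y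
third-vertex x y with y Fin.≟ x
... | yes refl = punchIn x zero , FinP.punchInᵢ≢i x zero , FinP.punchInᵢ≢i x zero
... | no y≢x = punchIn x j , FinP.punchInᵢ≢i x j ,
  λ e → FinP.punchInᵢ≢i y′ zero
    (FinP.punchIn-injective x j y′ (trans e (sym (FinP.punchIn-punchOut (≢-sym y≢x)))))
  where
  y′ : Fin (2 + _)
  y′ = punchOut (≢-sym y≢x)
  j : Fin (2 + _)
  j = punchIn y′ zero

injective-missing⇒< : ∀ {m n} (f : Fin m → Fin n) → Injective _≡_ _≡_ f →
  ∀ q → (∀ x → f x ≢ q) → m < n
injective-missing⇒< {n = suc n} f f-inj q f≢q =
  s≤s (FinP.injective⇒≤ {f = λ x → punchOut (≢-sym (f≢q x))}
    (f-inj ∘ FinP.punchOut-injective (≢-sym (f≢q _)) (≢-sym (f≢q _))))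

join-injective : ∀ m n → Injective _≡_ _≡_ (Fin.join m n)
join-injective m n {x} {y} e = begin
  x                            ≡⟨ FinP.splitAt-join m n x ⟨
  Fin.splitAt m (Fin.join m n x) ≡⟨ cong (Fin.splitAt m) e ⟩
  Fin.splitAt m (Fin.join m n y) ≡⟨ FinP.splitAt-join m n y ⟩
  y                            ∎
  where open ≡-Reasoning

half-< : ∀ {N m k} → N ≡ 2 * m → N < k + k → m + 1 ≤ k
half-< {m = m} {k} refl lt =
  subst (_≤ k) (ℕ.+-comm 1 m)
    (ℕ.*-cancelˡ-< 2 m k (subst (2 * m <_) (cong (k +_) (sym (ℕ.+-identityʳ k))) lt))

half-≡ : ∀ {N m ℓ} → N ≡ 2 * m → ℓ + ℓ ≡ N → suc ℓ ≡ m + 1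
half-≡ {m = m} {ℓ} refl ℓ+ℓ≡N =
  trans (cong suc (ℕ.*-cancelˡ-≡ ℓ m 2 (trans (cong (ℓ +_) (ℕ.+-identityʳ ℓ)) ℓ+ℓ≡N)))
        (ℕ.+-comm 1 m)

module _ {N : ℕ} (G : Graph N) where
  open Graph G using (adj; irrefl) renaming (sym to adj-sym)

  Diameter≤2 : Set
  Diameter≤2 = ∀ x y → x ≢ y → ¬ Adj G x y → ∃ λ w → Adj G x w × Adj G w y

  diameter≤2⇒rainbow : Diameter≤2 → ∀ {k} (c : Fin N → Fin k) → IsRainbowColoring G c
  diameter≤2⇒rainbow diam c x y x≢y with T? (adj x y)
  ... | yes xy = [] , xy ∷ [-] , (x≢y ∷ []) ∷ [] ∷ [] , []
  ... | no ¬xy with diam x y x≢y ¬xy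
  ...   | w , xw , wy =
    w ∷ [] , xw ∷ wy ∷ [-] , (x≢w ∷ x≢y ∷ []) ∷ (w≢y ∷ []) ∷ [] ∷ [] , [] ∷ []
    where
    x≢w : x ≢ w
    x≢w refl = irrefl x xw
    w≢y : w ≢ y
    w≢y refl = irrefl w wy

  setDist-unique : ∀ {v S a b} → SetDist G v S a → SetDist G v S b → a ≡ b
  setDist-unique ((y , y∈S , walk-a) , a-min) ((z , z∈S , walk-b) , b-min) =
    ℕ.≤-antisym (a-min z _ z∈S walk-b) (b-min y _ y∈S walk-a)

  record CocktailParty : Set where
    field
      partner             : Fin N → Fin N
      partner-≢           : ∀ v → partner v ≢ v
      partner-nonadjacent : ∀ v → ¬ Adj G v (partner v)
      nonadjacent⇒partner : ∀ {v w} → w ≢ v → ¬ Adj G v w → w ≡ partner v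

    partner-involutive : ∀ v → partner (partner v) ≡ v
    partner-involutive v = sym (nonadjacent⇒partner (≢-sym (partner-≢ v))
      (partner-nonadjacent v ∘ adj-sym (partner v) v))

    partner-injective : Injective _≡_ _≡_ partner
    partner-injective {u} {v} e =
      trans (sym (partner-involutive u)) (trans (cong partner e) (partner-involutive v))

    adjacent-unless-partner : ∀ {v w} → w ≢ v → w ≢ partner v → Adj G v w
    adjacent-unless-partner {v} {w} w≢v w≢pv =
      decidable-stable (T? (adj v w)) (w≢pv ∘ nonadjacent⇒partner w≢v)

  degree≡N∸2⇒cocktailParty : 2 ≤ N → (∀ v → degree G v ≡ N ∸ 2) → CocktailParty
  degree≡N∸2⇒cocktailParty 2≤N deg = record
    { partner             = λ v → proj₁ (other v)
    ; partner-≢           = λ v → proj₁ (proj₂ (proj₂ (other v)))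
    ; partner-nonadjacent = λ v → nonNeighbour⇒nonadjacent (proj₁ (proj₂ (other v)))
    ; nonadjacent⇒partner = λ w≢v ¬vw → proj₂ (proj₂ (proj₂ (other _))) (nonadjacent⇒nonNeighbour ¬vw) w≢v
    }
    where
    nonNeighbours : Fin N → List (Fin N)
    nonNeighbours v = filter (¬? ∘ T? ∘ adj v) (allFin N)

    nonadjacent⇒nonNeighbour : ∀ {v w} → ¬ Adj G v w → w ∈ nonNeighbours v
    nonadjacent⇒nonNeighbour {v} = ∈-filter⁺ (¬? ∘ T? ∘ adj v) (∈-allFin _)

    nonNeighbour⇒nonadjacent : ∀ {v w} → w ∈ nonNeighbours v → ¬ Adj G v w
    nonNeighbour⇒nonadjacent {v} = proj₂ ∘ ∈-filter⁻ (¬? ∘ T? ∘ adj v) {xs = allFin N}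

    nonNeighbours-length : ∀ v → length (nonNeighbours v) ≡ 2
    nonNeighbours-length v = ℕ.+-cancelˡ-≡ (N ∸ 2) _ _ (begin
      N ∸ 2 + length (nonNeighbours v)      ≡⟨ cong (_+ length (nonNeighbours v)) (deg v) ⟨
      degree G v + length (nonNeighbours v) ≡⟨ length-filter-complement (T? ∘ adj v) (allFin N) ⟩
      length (allFin N)                     ≡⟨ length-tabulate (λ w → w) ⟩
      N                                     ≡⟨ ℕ.m∸n+n≡m 2≤N ⟨
      N ∸ 2 + 2                             ∎)
      where open ≡-Reasoning

    other : ∀ v → ∃ λ w → w ∈ nonNeighbours v × w ≢ v ×
                          (∀ {z} → z ∈ nonNeighbours v → z ≢ v → z ≡ w)
    other v = other-in-pair (filter⁺ (¬? ∘ T? ∘ adj v) (allFin⁺ N)) (nonNeighbours-length v)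
      (nonadjacent⇒nonNeighbour (irrefl v))

cocktailParty⇒diameter≤2 : ∀ {n} {G : Graph (3 + n)} → CocktailParty G → Diameter≤2 G
cocktailParty⇒diameter≤2 {G = G} cp x y x≢y ¬xy with third-vertex x y
... | w , w≢x , w≢y =
  w , adjacent-unless-partner w≢x (λ e → w≢y (trans e (sym y≡px))) ,
      Graph.sym G y w (adjacent-unless-partner w≢y (λ e → w≢x (trans e py≡x)))
  where
  open CocktailParty cp
  y≡px : y ≡ partner x
  y≡px = nonadjacent⇒partner (≢-sym x≢y) ¬xy
  py≡x : partner y ≡ x
  py≡x = trans (cong partner y≡px) (partner-involutive x)

module ColourDistance {N : ℕ} (G : Graph N) {k : ℕ} (c : Fin N → Fin k) where
  open Graph G using (adj)

  data Distance (v : Fin N) (i : Fin k) : ℕ → Set where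
    inside   : c v ≡ i → Distance v i 0
    adjacent : ∀ {y} → c v ≢ i → c y ≡ i → Adj G v y → Distance v i 1
    apart    : c v ≢ i → (∀ {y} → c y ≡ i → ¬ Adj G v y) → Distance v i 2

  distance : ∀ v i → ∃ (Distance v i)
  distance v i with c v Fin.≟ i
  ... | yes cv≡i = 0 , inside cv≡i
  ... | no cv≢i with FinP.any? (λ y → (c y Fin.≟ i) ×-dec T? (adj v y))
  ...   | yes (y , cy≡i , vy) = 1 , adjacent cv≢i cy≡i vy
  ...   | no none             = 2 , apart cv≢i (λ cy≡i vy → none (_ , cy≡i , vy))

  code : Fin N → Fin k → ℕ
  code v i = proj₁ (distance v i)

  code-view : ∀ {v i d} → code v i ≡ d → Distance v i d
  code-view {v} {i} refl = proj₂ (distance v i)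

  code-correct : Diameter≤2 G → Surjective _≡_ _≡_ c → ∀ v → IsRainbowCode G c v (code v)
  code-correct diam surj v i = setDist (proj₂ (distance v i))
    where
    setDist : ∀ {d} → Distance v i d → SetDist G v (R G c i) d
    setDist (inside cv≡i) = (v , cv≡i , here) , λ _ _ _ _ → z≤n
    setDist (adjacent cv≢i cy≡i vy) = (_ , cy≡i , step vy here) , λ
      { _ _ cv≡i here → ⊥-elim (cv≢i cv≡i)
      ; _ _ _ (step _ _) → s≤s z≤n }
    setDist (apart cv≢i far) with proj₁ (surj i) | proj₂ (surj i) refl
    ... | y | cy≡i with diam v y (λ { refl → cv≢i cy≡i }) (far cy≡i)
    ...   | w , vw , wy = (y , cy≡i , step vw (step wy here)) , λ
      { _ _ cv≡i here → ⊥-elim (cv≢i cv≡i)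
      ; _ _ cz≡i (step vz here) → ⊥-elim (far cz≡i vz)
      ; _ _ _ (step _ (step _ _)) → s≤s (s≤s z≤n) }

  code-self : ∀ v → code v (c v) ≡ 0
  code-self v with distance v (c v)
  ... | _ , inside _         = refl
  ... | _ , adjacent cv≢cv _ _ = ⊥-elim (cv≢cv refl)
  ... | _ , apart cv≢cv _    = ⊥-elim (cv≢cv refl)

  same-code⇒same-colour : ∀ {u v} → code u (c v) ≡ code v (c v) → c u ≡ c v
  same-code⇒same-colour {u} {v} e with code-view (trans e (code-self v))
  ... | inside cu≡cv = cu≡cv

  apart⇒code≡2 : ∀ {v i} → c v ≢ i → (∀ {y} → c y ≡ i → ¬ Adj G v y) → code v i ≡ 2
  apart⇒code≡2 {v} {i} cv≢i far with distance v i
  ... | _ , inside cv≡i           = ⊥-elim (cv≢i cv≡i)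
  ... | _ , adjacent _ cy≡i vy    = ⊥-elim (far cy≡i vy)
  ... | _ , apart _ _             = refl

  code≢2⇒determined-by-colour : ∀ {u v} i → c u ≡ c v → code u i ≢ 2 → code v i ≢ 2 →
    code u i ≡ code v i
  code≢2⇒determined-by-colour {u} {v} i cu≡cv with distance u i | distance v i
  ... | _ , inside _         | _ , inside _          = λ _ _ → refl
  ... | _ , inside cu≡i      | _ , adjacent cv≢i _ _ = ⊥-elim (cv≢i (trans (sym cu≡cv) cu≡i))
  ... | _ , adjacent cu≢i _ _ | _ , inside cv≡i      = ⊥-elim (cu≢i (trans cu≡cv cv≡i))
  ... | _ , adjacent _ _ _   | _ , adjacent _ _ _    = λ _ _ → refl
  ... | _ , apart _ _        | _                     = λ u≢2 _ → ⊥-elim (u≢2 refl)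
  ... | _                    | _ , apart _ _         = λ _ v≢2 → ⊥-elim (v≢2 refl)

  CodesSeparate : Set
  CodesSeparate = ∀ {u v} → (∀ i → code u i ≡ code v i) → u ≡ v

  locating⇒codes-separate : Diameter≤2 G → IsLocatingRainbowColoring G c → CodesSeparate
  locating⇒codes-separate diam (surj , _ , locates) {u} {v} =
    locates u v (code u) (code v) (code-correct diam surj u) (code-correct diam surj v)

  codes-separate⇒locating : Diameter≤2 G → Surjective _≡_ _≡_ c → CodesSeparate →
    IsLocatingRainbowColoring G c
  codes-separate⇒locating diam surj separate = surj , diameter≤2⇒rainbow G diam c ,
    λ u v ru rv u-code v-code ru≡rv → separate λ i →
      trans (sym (code≡ u-code i)) (trans (ru≡rv i) (code≡ v-code i))
    where
    code≡ : ∀ {v r} → IsRainbowCode G c v r → ∀ i → r i ≡ code v i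
    code≡ {v} r-code i = setDist-unique G (r-code i) (code-correct diam surj v i)

module CocktailPartyColourings {n : ℕ} {G : Graph (3 + n)} (cp : CocktailParty G) where
  open CocktailParty cp

  diam : Diameter≤2 G
  diam = cocktailParty⇒diameter≤2 cp

  module _ {k : ℕ} (c : Fin (3 + n) → Fin k) where
    open ColourDistance G c

    code≡2⇒partner : ∀ {v i y} → code v i ≡ 2 → c y ≡ i → v ≡ partner y
    code≡2⇒partner {v} {i} {y} e cy≡i with code-view e
    ... | apart cv≢i far =
      nonadjacent⇒partner (λ { refl → cv≢i cy≡i }) (far cy≡i ∘ Graph.sym G y v)

  module LowerBound {k : ℕ} {c : Fin (3 + n) → Fin k} (loc : IsLocatingRainbowColoring G c) where
    open ColourDistance G c

    signature : Fin (3 + n) → Fin k ⊎ Fin k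
    signature v with FinP.any? (λ i → code v i ℕ.≟ 2)
    ... | yes (i , _) = inj₂ i
    ... | no _        = inj₁ (c v)

    signature-injective : Injective _≡_ _≡_ signature
    signature-injective {u} {v} e
      with FinP.any? (λ i → code u i ℕ.≟ 2) | FinP.any? (λ i → code v i ℕ.≟ 2) | e
    ... | yes (i , u-far) | yes (_ , v-far) | refl =
      trans (code≡2⇒partner c u-far member) (sym (code≡2⇒partner c v-far member))
      where
      member : c (proj₁ (proj₁ loc i)) ≡ i
      member = proj₂ (proj₁ loc i) refl
    ... | yes _ | no _ | ()
    ... | no _ | yes _ | ()
    ... | no u-near | no v-near | e′ = locating⇒codes-separate diam loc λ i →
      code≢2⇒determined-by-colour i (inj₁-injective e′) (u-near ∘ (i ,_)) (v-near ∘ (i ,_))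

    signature-misses : ∀ {a b} → a ≢ b → c a ≡ c b → ∀ v → signature v ≢ inj₂ (c a)
    signature-misses {a} {b} a≢b ca≡cb v with FinP.any? (λ i → code v i ℕ.≟ 2)
    ... | yes (_ , v-far) = λ { refl → a≢b (partner-injective
          (trans (sym (code≡2⇒partner c v-far refl)) (code≡2⇒partner c v-far (sym ca≡cb)))) }
    ... | no _ = λ ()

    lower-bound : 3 + n < k + k
    lower-bound with k ℕ.<? 3 + n
    ... | yes k<N with FinP.pigeonhole k<N c
    ...   | a , b , a<b , ca≡cb = injective-missing⇒< (Fin.join k k ∘ signature)
            (signature-injective ∘ join-injective k k) (Fin.join k k (inj₂ (c a)))
            (λ v → signature-misses (FinP.<⇒≢ a<b) ca≡cb v ∘ join-injective k k)
    lower-bound | no k≮N = ℕ.≤-<-trans N≤k (ℕ.m<m+n k (ℕ.≤-trans (s≤s z≤n) N≤k))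
      where
      N≤k : 3 + n ≤ k
      N≤k = ℕ.≮⇒≥ k≮N

  module UpperBound where
    Rep : Pred (Fin (3 + n)) 0ℓ
    Rep v = v Fin.< partner v

    rep? : Decidable Rep
    rep? v = v FinP.<? partner v

    rep⇒¬rep-partner : ∀ {v} → Rep v → ¬ Rep (partner v)
    rep⇒¬rep-partner {v} r r′ = FinP.<-asym r (subst (partner v Fin.<_) (partner-involutive v) r′)

    ¬rep⇒rep-partner : ∀ {v} → ¬ Rep v → Rep (partner v)
    ¬rep⇒rep-partner {v} ¬r = subst (partner v Fin.<_) (sym (partner-involutive v))
      (FinP.≤∧≢⇒< (ℕ.≮⇒≥ ¬r) (partner-≢ v))

    reps : List (Fin (3 + n))
    reps = filter rep? (allFin (3 + n))

    ℓ : ℕ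
    ℓ = length reps

    nonreps : List (Fin (3 + n))
    nonreps = filter (¬? ∘ rep?) (allFin (3 + n))

    reps-double : ℓ + ℓ ≡ 3 + n
    reps-double = begin
      ℓ + ℓ                   ≡⟨ cong (ℓ +_) (ℕ.≤-antisym
        (length-filter-≤-via-injection rep? (¬? ∘ rep?) partner partner-injective rep⇒¬rep-partner)
        (length-filter-≤-via-injection (¬? ∘ rep?) rep? partner partner-injective ¬rep⇒rep-partner)) ⟩
      ℓ + length nonreps      ≡⟨ length-filter-complement rep? (allFin (3 + n)) ⟩
      length (allFin (3 + n)) ≡⟨ length-tabulate (λ v → v) ⟩
      3 + n                   ∎
      where open ≡-Reasoning

    colour : Fin (3 + n) → Fin (suc ℓ)
    colour v with rep? v
    ... | yes r = suc (index (∈-filter⁺ rep? (∈-allFin v) r))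
    ... | no _  = zero

    colour-injective : ∀ {u v} → colour u ≡ colour v → colour u ≢ zero → u ≡ v
    colour-injective {u} {v} e with rep? u | rep? v | e
    ... | yes _ | yes _ | e′ =
      λ _ → SetoidMembership.index-injective (setoid _) _ _ (FinP.suc-injective e′)
    ... | yes _ | no _  | ()
    ... | no _  | _     | _  = λ u≢0 → ⊥-elim (u≢0 refl)

    partner-colour≢zero : ∀ v → colour v ≡ zero → colour (partner v) ≢ zero
    partner-colour≢zero v with rep? v | rep? (partner v)
    ... | yes _ | _      = λ ()
    ... | no _  | yes _  = λ _ ()
    ... | no ¬r | no ¬r′ = ⊥-elim (¬r′ (¬rep⇒rep-partner ¬r))

    colour-nonrep : ∀ {v} → ¬ Rep v → colour v ≡ zero
    colour-nonrep {v} ¬r with rep? v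
    ... | yes r = ⊥-elim (¬r r)
    ... | no _  = refl

    colour-lookup : ∀ j → colour (lookup reps j) ≡ suc j
    colour-lookup j with rep? (lookup reps j)
    ... | yes r  = cong suc (lookup-injective (filter⁺ rep? (allFin⁺ _))
                     (sym (lookup-index (∈-filter⁺ rep? (∈-allFin _) r))))
    ... | no ¬r = ⊥-elim (¬r (proj₂ (∈-filter⁻ rep? {xs = allFin _} (∈-lookup j))))

    colour-surjective : Surjective _≡_ _≡_ colour
    colour-surjective zero with rep? zero
    ... | yes r  = partner zero , λ { refl → colour-nonrep (rep⇒¬rep-partner r) }
    ... | no ¬r = zero , λ { refl → colour-nonrep ¬r }
    colour-surjective (suc j) = lookup reps j , λ { refl → colour-lookup j }

    open ColourDistance G colour

    codes-separate : CodesSeparate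
    codes-separate {u} {v} e with colour u Fin.≟ zero
    ... | no cu≢0   = colour-injective (same-code⇒same-colour (e (colour v))) cu≢0
    ... | yes cu≡0 = trans (sym (partner-involutive u)) (sym (code≡2⇒partner colour v-far refl))
      where
      partner-colour-singleton : ∀ {y} → colour y ≡ colour (partner u) → y ≡ partner u
      partner-colour-singleton cy≡ =
        colour-injective cy≡ (λ cy≡0 → partner-colour≢zero u cu≡0 (trans (sym cy≡) cy≡0))
      u-far : code u (colour (partner u)) ≡ 2
      u-far = apart⇒code≡2 (λ cu≡ → partner-colour≢zero u cu≡0 (trans (sym cu≡) cu≡0))
        (λ cy≡ → subst (¬_ ∘ Adj G u) (sym (partner-colour-singleton cy≡)) (partner-nonadjacent u))
      v-far : code v (colour (partner u)) ≡ 2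
      v-far = trans (sym (e _)) u-far

    locating : IsLocatingRainbowColoring G colour
    locating = codes-separate⇒locating diam colour-surjective codes-separate

theorem5 : (n m : ℕ) → n ≡ 2 * m → 4 ≤ n → (G : Graph n) →
    (∀ v → degree G v ≡ n ∸ 2) → RVCL≡ G (m + 1)
theorem5 (suc (suc (suc (suc n)))) m n≡2m (s≤s (s≤s (s≤s (s≤s _)))) G deg =
  subst (HasLocatingRainbowColoring G) (half-≡ n≡2m reps-double) (colour , locating) ,
  λ k (c , loc) → half-< n≡2m (LowerBound.lower-bound loc)
  where
  open CocktailPartyColourings (degree≡N∸2⇒cocktailParty G (s≤s (s≤s z≤n)) deg)
  open UpperBound
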